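{- Let $n\ge1$ and $A\in\mathrm{Int}(n)$. Then all entries of $A$ lie in $\{0,1\}$ if and only if the ascent sequence $x=\Gamma(A)=(x_1,\dots,x_n)$ has no two equal consecutive entries (i.e. $x_i\neq x_{i+1}$ for all $1\le i<n$).
   Context: $\mathrm{Int}(n)$ is the set of upper triangular square matrices with non-negative integer entries summing to $n$ such that every row and column has a non-zero entry. For such $A$: $\dim(A)$ is the number of rows, $\mathrm{index}(A)$ the smallest $i$ with $A_{i,\dim(A)}>0$, $\mathrm{val}(A)=A_{\mathrm{index}(A),\dim(A)}$. For a sequence $y$, $\mathrm{asc}(y)$ is the number of $i$ with $y_i<y_{i+1}$; $\mathrm{Asc}(n)$ is the set of integer sequences $(x_1,\dots,x_n)$ with $x_1=0$ and $x_i\in[0,1+\mathrm{asc}(x_1,\dots,x_{i-1})]$ for $1<i\le n$. Removal operation $f$ on $A\in\mathrm{Int}(n)$, $n\ge2$: (Rem1) if $\mathrm{val}(A)>1$, or if $\mathrm{val}(A)=1$, $\mathrm{index}(A)<\dim(A)$ and row $\mathrm{index}(A)$ has another positive entry, decrease entry $(\mathrm{index}(A),\dim(A))$ by $1$; (Rem2) if $\mathrm{val}(A)=1$ and $\mathrm{index}(A)=\dim(A)$, delete last row and column; (Rem3) if $\mathrm{val}(A)=1$, $\mathrm{index}(A)<\dim(A)$ and all other entries of row $\mathrm{index}(A)$ are $0$, set $A_{i,\dim(A)}:=A_{i,\mathrm{index}(A)}$ for $1\le i\le\mathrm{index}(A)-1$, then delete row and column $\mathrm{index}(A)$. $\Gamma:\mathrm{Int}(n)\to\mathrm{Asc}(n)$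 (a bijection): $\Gamma((1))=(0)$ and for $n\ge2$, $\Gamma(A)$ is $\Gamma(f(A))$ with $\mathrm{index}(A)-1$ appended. -}

module Defs where

open import Data.Nat using (ℕ; zero; suc; _+_; _∸_; _<ᵇ_; _≡ᵇ_; _<_; _>_)
open import Data.Bool using (Bool; true; false; if_then_else_; _∧_; _∨_; not)
open import Data.Fin using (Fin; toℕ; fromℕ; inject₁; punchIn)
open import Data.Maybe using (Maybe; just; nothing)
open import Data.List using (List; []; _∷_; [_]; _++_)
open import Relation.Binary.PropositionalEquality using (_≡_)
open import Data.Product using (_×_)

record Mat : Set where
  constructor mat
  field
    dim : ℕ
    ent : Fin dim → Fin dim → ℕ
open Mat public

sumFin : (m : ℕ) → (Fin m → ℕ) → ℕ
sumFin zero    g = 0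
sumFin (suc m) g = g Fin.zero + sumFin m (λ i → g (Fin.suc i))

anyFin : (m : ℕ) → (Fin m → Bool) → Bool
anyFin zero    p = false
anyFin (suc m) p = p Fin.zero ∨ anyFin m (λ i → p (Fin.suc i))

findFirst : (m : ℕ) → (Fin m → Bool) → Maybe (Fin m)
findFirst zero    p = nothing
findFirst (suc m) p with p Fin.zero
... | true  = just Fin.zero
... | false with findFirst m (λ i → p (Fin.suc i))
...   | just i  = just (Fin.suc i)
...   | nothing = nothing

_==F_ : ∀ {m} → Fin m → Fin m → Bool
i ==F j = toℕ i ≡ᵇ toℕ j

record IsInt (n : ℕ) (A : Mat) : Set where
  field
    upper  : ∀ i j → toℕ j < toℕ i → ent A i j ≡ 0
    total  : sumFin (dim A) (λ i → sumFin (dim A) (λ j → ent A i j)) ≡ n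
    rowNZ  : ∀ i → anyFin (dim A) (λ j → 0 <ᵇ ent A i j) ≡ true
    colNZ  : ∀ j → anyFin (dim A) (λ i → 0 <ᵇ ent A i j) ≡ true

index : (k : ℕ) → (Fin (suc k) → Fin (suc k) → ℕ) → Maybe (Fin (suc k))
index k M = findFirst (suc k) (λ i → 0 <ᵇ M i (fromℕ k))

-- The removal operation f (Rem1, Rem2, Rem3).  Outside Int(n) (where
-- index(A) may not exist) it is the identity; this case never occurs on Int(n).
removal : Mat → Mat
removal (mat zero M) = mat zero M
removal (mat (suc k) M) with index k M
... | nothing = mat (suc k) M
... | just i =
  if 1 <ᵇ val then rem1
  else if i ==F lst then rem2
  else if anyFin (suc k) (λ j → not (j ==F lst) ∧ (0 <ᵇ M i j)) then rem1
  else rem3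
  where
  lst : Fin (suc k)
  lst = fromℕ k
  val : ℕ
  val = M i lst
  rem1 : Mat
  rem1 = mat (suc k) (λ r c → if (r ==F i) ∧ (c ==F lst) then M r c ∸ 1 else M r c)
  rem2 : Mat
  rem2 = mat k (λ r c → M (inject₁ r) (inject₁ c))
  M'' : Fin (suc k) → Fin (suc k) → ℕ
  M'' r c = if (c ==F lst) ∧ (toℕ r <ᵇ toℕ i) then M r i else M r c
  rem3 : Mat
  rem3 = mat k (λ r c → M'' (punchIn i r) (punchIn i c))

-- index(A) - 1 in the paper's 1-based convention = toℕ of the 0-based index.
index-1 : Mat → ℕ
index-1 (mat zero M) = 0
index-1 (mat (suc k) M) with index k M
... | nothing = 0
... | just i  = toℕ i

Γ : ℕ → Mat → List ℕ
Γ zero          A = []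
Γ (suc zero)    A = [ 0 ]
Γ (suc (suc n)) A = Γ (suc n) (removal A) ++ [ index-1 A ]

-- Γ(A) is Γ(f(A)) followed by index(A) − 1, and f(A) ∈ Int(n − 1) again, so by induction on n it
-- suffices to compare A with B = f(A), whose sequence ends in index(B) − 1.  If val(A) > 1, then A is
-- not a 0/1-matrix and Rem1 keeps index(B) = index(A): the last two entries of Γ(A) coincide.  In all
-- other cases every entry of A above 1 would be bounded by an entry of B and conversely (Rem1 lowers a
-- 1 to 0, Rem2 deletes a 1 and zeros, Rem3 deletes a 1 and zeros and moves column index(A) into the
-- last column), so A is a 0/1-matrix iff B is; and index(B) ≠ index(A), because Rem1 zeroes the entry
-- (index(A), dim A), Rem2 shrinks the dimension to index(A) − 1, and Rem3 moves a positive entry of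
-- column index(A), which lies strictly above row index(A), into the last column.
module Submission where

open import Defs
open import Data.Nat as ℕ using (ℕ; zero; suc; _+_; _∸_; _≤_; _<_; _<ᵇ_; z≤n; s≤s; z<s)
open import Data.Nat.Properties
open import Data.Fin as Fin using (Fin; toℕ; fromℕ; inject₁; punchIn; punchOut)
import Data.Fin.Properties as Finₚ
open import Data.Bool using (Bool; true; false; if_then_else_; _∧_; not)
open import Data.Product using (∃; ∃₂; _×_; _,_; proj₁; proj₂)
open import Data.Sum using (_⊎_; inj₁; inj₂; [_,_]′)
open import Data.Empty using (⊥-elim)
open import Data.Maybe using (Maybe; just; nothing)
open import Relation.Nullary using (¬_; contradiction; yes; no)
open import Relation.Nullary.Reflects using (Reflects; ofʸ; ofⁿ; fromEquivalence; det; ¬-reflects; _×-reflects_)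
open import Relation.Binary.Definitions using (tri<; tri≈; tri>)
open import Relation.Binary.PropositionalEquality hiding ([_])
open import Function.Base using (_∘_)
open import Function.Bundles using (_⇔_; mk⇔; Equivalence)
open import Data.List using (List; []; _∷_; [_]; _++_)
open import Data.List.Relation.Unary.Linked using (Linked; []; [-]; _∷_)
import Algebra.Properties.CommutativeMonoid.Sum +-0-commutativeMonoid as Sum
import Algebra.Properties.CommutativeSemigroup +-commutativeSemigroup as +-CS

≡0⇒≤ : ∀ {m n} → m ≡ 0 → m ≤ n
≡0⇒≤ refl = z≤n

1≮n∧0<n⇒n≡1 : ∀ {n} → ¬ 1 < n → 0 < n → n ≡ 1
1≮n∧0<n⇒n≡1 1≮n 0<n = ≤-antisym (≮⇒≥ 1≮n) 0<n

==F-reflects : ∀ {m} (i j : Fin m) → Reflects (i ≡ j) (i ==F j)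
==F-reflects i j = fromEquivalence (Finₚ.toℕ-injective ∘ ≡ᵇ⇒≡ _ _) (≡⇒≡ᵇ _ _ ∘ cong toℕ)

==F-refl : ∀ {m} (i : Fin m) → (i ==F i) ≡ true
==F-refl i = det (==F-reflects i i) (ofʸ refl)

==F-≢ : ∀ {m} {i j : Fin m} → i ≢ j → (i ==F j) ≡ false
==F-≢ {i = i} {j} i≢j = det (==F-reflects i j) (ofⁿ i≢j)

anyFin-reflects : ∀ {m} {P : Fin m → Set} {p : Fin m → Bool} →
                  (∀ j → Reflects (P j) (p j)) → Reflects (∃ P) (anyFin m p)
anyFin-reflects {zero}  r = ofⁿ λ ()
anyFin-reflects {suc m} {p = p} r with p Fin.zero | r Fin.zero
... | true  | ofʸ p₀ = ofʸ (Fin.zero , p₀)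
... | false | ofⁿ ¬p₀ with anyFin m (p ∘ Fin.suc) | anyFin-reflects (r ∘ Fin.suc)
...   | true  | ofʸ (j , pj) = ofʸ (Fin.suc j , pj)
...   | false | ofⁿ none     = ofⁿ λ { (Fin.zero , p₀) → ¬p₀ p₀ ; (Fin.suc j , pj) → none (j , pj) }

record Least {m} (P : Fin m → Set) (i : Fin m) : Set where
  field
    holds : P i
    below : ∀ j → j Fin.< i → ¬ P j

data FirstWitness {m} (P : Fin m → Set) : Maybe (Fin m) → Set where
  just    : ∀ {i} → Least P i → FirstWitness P (just i)
  nothing : (∀ j → ¬ P j) → FirstWitness P nothing

findFirst-witness : ∀ {m} {P : Fin m → Set} {p : Fin m → Bool} →
                    (∀ j → Reflects (P j) (p j)) → FirstWitness P (findFirst m p)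
findFirst-witness {zero}  r = nothing λ ()
findFirst-witness {suc m} {P} {p} r with p Fin.zero | r Fin.zero
... | true  | ofʸ p₀ = just (record { holds = p₀ ; below = λ _ () })
... | false | ofⁿ ¬p₀ with findFirst m (p ∘ Fin.suc) | findFirst-witness (r ∘ Fin.suc)
...   | just i  | just l = just (record { holds = Least.holds l ; below = below })
  where
  below : ∀ j → j Fin.< Fin.suc i → ¬ P j
  below Fin.zero    _         = ¬p₀
  below (Fin.suc j) (s≤s j<i) = Least.below l j j<i
...   | nothing | nothing none = nothing λ { Fin.zero → ¬p₀ ; (Fin.suc j) → none j }

Least-unique : ∀ {m} {P : Fin m → Set} {i j} → Least P i → Least P j → i ≡ j
Least-unique {i = i} {j} li lj with Finₚ.<-cmp i j
... | tri< i<j _ _ = contradiction (Least.holds li) (Least.below lj i i<j)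
... | tri≈ _ i≡j _ = i≡j
... | tri> _ _ j<i = contradiction (Least.holds lj) (Least.below li j j<i)

sumFin-cong : ∀ m {g h : Fin m → ℕ} → (∀ i → g i ≡ h i) → sumFin m g ≡ sumFin m h
sumFin-cong zero    g≗h = refl
sumFin-cong (suc m) g≗h = cong₂ _+_ (g≗h Fin.zero) (sumFin-cong m (g≗h ∘ Fin.suc))

sumFin-zero : ∀ m {g : Fin m → ℕ} → (∀ i → g i ≡ 0) → sumFin m g ≡ 0
sumFin-zero zero    g≗0 = refl
sumFin-zero (suc m) g≗0 = cong₂ _+_ (g≗0 Fin.zero) (sumFin-zero m (g≗0 ∘ Fin.suc))

sumFin≡sum : ∀ m (g : Fin m → ℕ) → sumFin m g ≡ Sum.sum g
sumFin≡sum zero    g = refl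
sumFin≡sum (suc m) g = cong (g Fin.zero +_) (sumFin≡sum m (g ∘ Fin.suc))

sumFin-punchIn : ∀ m (i : Fin (suc m)) (g : Fin (suc m) → ℕ) →
                 sumFin (suc m) g ≡ g i + sumFin m (g ∘ punchIn i)
sumFin-punchIn m i g = begin
  sumFin (suc m) g                ≡⟨ sumFin≡sum (suc m) g ⟩
  Sum.sum g                       ≡⟨ Sum.sum-remove {i = i} g ⟩
  g i + Sum.sum (g ∘ punchIn i)   ≡⟨ cong (g i +_) (sumFin≡sum m (g ∘ punchIn i)) ⟨
  g i + sumFin m (g ∘ punchIn i)  ∎
  where open ≡-Reasoning

≤-sumFin : ∀ m (g : Fin m → ℕ) i → g i ≤ sumFin m g
≤-sumFin (suc m) g i = subst (g i ≤_) (sym (sumFin-punchIn m i g)) (m≤m+n (g i) _)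

sumFin-update : ∀ m {g g′ : Fin (suc m) → ℕ} j {d} → (∀ x → x ≢ j → g′ x ≡ g x) →
                g′ j + d ≡ g j → sumFin (suc m) g′ + d ≡ sumFin (suc m) g
sumFin-update m {g} {g′} j {d} same at-j = begin
  sumFin (suc m) g′ + d                     ≡⟨ cong (_+ d) (sumFin-punchIn m j g′) ⟩
  g′ j + sumFin m (g′ ∘ punchIn j) + d      ≡⟨ cong (λ s → g′ j + s + d) rest ⟩
  g′ j + sumFin m (g ∘ punchIn j) + d       ≡⟨ +-CS.xy∙z≈xz∙y (g′ j) _ d ⟩
  g′ j + d + sumFin m (g ∘ punchIn j)       ≡⟨ cong (_+ sumFin m (g ∘ punchIn j)) at-j ⟩
  g j + sumFin m (g ∘ punchIn j)            ≡⟨ sumFin-punchIn m j g ⟨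
  sumFin (suc m) g                          ∎
  where
  open ≡-Reasoning
  rest : sumFin m (g′ ∘ punchIn j) ≡ sumFin m (g ∘ punchIn j)
  rest = sumFin-cong m (λ x → same (punchIn j x) (Finₚ.punchInᵢ≢i j x))

punchIn-surjective : ∀ {m} (i r : Fin (suc m)) → r ≢ i → ∃ λ r′ → punchIn i r′ ≡ r
punchIn-surjective i r r≢i = punchOut (r≢i ∘ sym) , Finₚ.punchIn-punchOut (r≢i ∘ sym)

punchIn-mono-< : ∀ {m} (i : Fin (suc m)) (j k : Fin m) → j Fin.< k → punchIn i j Fin.< punchIn i k
punchIn-mono-< i j k j<k = ≰⇒> (<⇒≱ j<k ∘ Finₚ.punchIn-cancel-≤ i k j)

toℕ≤toℕ-punchIn : ∀ {m} (i : Fin (suc m)) (j : Fin m) → toℕ j ≤ toℕ (punchIn i j)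
toℕ≤toℕ-punchIn Fin.zero    j           = n≤1+n (toℕ j)
toℕ≤toℕ-punchIn (Fin.suc i) Fin.zero    = z≤n
toℕ≤toℕ-punchIn (Fin.suc i) (Fin.suc j) = s≤s (toℕ≤toℕ-punchIn i j)

punchIn-fromℕ-fromℕ : ∀ k (i : Fin (suc (suc k))) → i ≢ fromℕ (suc k) →
                      punchIn i (fromℕ k) ≡ fromℕ (suc k)
punchIn-fromℕ-fromℕ k       Fin.zero    _ = refl
punchIn-fromℕ-fromℕ zero    (Fin.suc Fin.zero) i≢last = contradiction refl i≢last
punchIn-fromℕ-fromℕ (suc k) (Fin.suc i) i≢last =
  cong Fin.suc (punchIn-fromℕ-fromℕ k i (i≢last ∘ cong Fin.suc))

punchIn-fromℕ : ∀ k (j : Fin k) → punchIn (fromℕ k) j ≡ inject₁ j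
punchIn-fromℕ (suc k) Fin.zero    = refl
punchIn-fromℕ (suc k) (Fin.suc j) = cong Fin.suc (punchIn-fromℕ k j)

inject₁-surjective : ∀ {k} (c : Fin (suc k)) → c ≢ fromℕ k → ∃ λ c′ → inject₁ c′ ≡ c
inject₁-surjective {k} c c≢L =
  let c′ , punch≡c = punchIn-surjective (fromℕ k) c c≢L
  in  c′ , trans (sym (punchIn-fromℕ k c′)) punch≡c

inject₁<fromℕ : ∀ {k} (c : Fin k) → inject₁ c Fin.< fromℕ k
inject₁<fromℕ {k} c = subst (toℕ (inject₁ c) <_) (sym (Finₚ.toℕ-fromℕ k)) (Finₚ.inject₁ℕ< c)

sumFin-fromℕ : ∀ k (g : Fin (suc k) → ℕ) → sumFin (suc k) g ≡ g (fromℕ k) + sumFin k (g ∘ inject₁)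
sumFin-fromℕ k g = trans (sumFin-punchIn k (fromℕ k) g)
                         (cong (g (fromℕ k) +_) (sumFin-cong k (cong g ∘ punchIn-fromℕ k)))

module _ {a ℓ} {X : Set a} {R : X → X → Set ℓ} where

  Linked-snoc⁺ : ∀ xs {x y} → Linked R (xs ++ [ x ]) → R x y → Linked R ((xs ++ [ x ]) ++ [ y ])
  Linked-snoc⁺ []           _           Rxy = Rxy ∷ [-]
  Linked-snoc⁺ (_ ∷ [])     (Rwx ∷ _)   Rxy = Rwx ∷ Rxy ∷ [-]
  Linked-snoc⁺ (_ ∷ _ ∷ xs) (Rwz ∷ Rzs) Rxy = Rwz ∷ Linked-snoc⁺ (_ ∷ xs) Rzs Rxy

  Linked-snoc⁻ : ∀ xs {x y} → Linked R ((xs ++ [ x ]) ++ [ y ]) → Linked R (xs ++ [ x ]) × R x y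
  Linked-snoc⁻ []           (Rxy ∷ _)       = [-] , Rxy
  Linked-snoc⁻ (_ ∷ [])     (Rwx ∷ Rxy ∷ _) = Rwx ∷ [-] , Rxy
  Linked-snoc⁻ (_ ∷ _ ∷ xs) (Rwz ∷ Rzs) =
    let Rzs′ , Rxy = Linked-snoc⁻ (_ ∷ xs) Rzs in Rwz ∷ Rzs′ , Rxy

  Linked-snoc⇔ : ∀ xs {x y} → Linked R ((xs ++ [ x ]) ++ [ y ]) ⇔ (Linked R (xs ++ [ x ]) × R x y)
  Linked-snoc⇔ xs = mk⇔ (Linked-snoc⁻ xs) (λ (l , r) → Linked-snoc⁺ xs l r)

Square : ℕ → Set
Square d = Fin d → Fin d → ℕ

rowSum : ∀ {d} → Square d → Fin d → ℕ
rowSum {d} M r = sumFin d (M r)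

entrySum : ∀ {d} → Square d → ℕ
entrySum {d} M = sumFin d (rowSum M)

entry≤entrySum : ∀ {d} (M : Square d) r c → M r c ≤ entrySum M
entry≤entrySum {d} M r c = ≤-trans (≤-sumFin d (M r) c) (≤-sumFin d (rowSum M) r)

record Int (n : ℕ) (A : Mat) : Set where
  field
    upper     : ∀ i j → j Fin.< i → ent A i j ≡ 0
    entrySum≡ : entrySum (ent A) ≡ n
    rowPos    : ∀ i → ∃ λ j → 0 < ent A i j
    colPos    : ∀ j → ∃ λ i → 0 < ent A i j
open Int

IsInt⇒Int : ∀ {n A} → IsInt n A → Int n A
IsInt⇒Int {A = A} h = record
  { upper     = IsInt.upper h
  ; entrySum≡ = IsInt.total h
  ; rowPos    = λ i → witness (IsInt.rowNZ h i)
  ; colPos    = λ j → witness (IsInt.colNZ h j)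
  }
  where
  witness : ∀ {P : Fin (dim A) → ℕ} → anyFin (dim A) (λ j → 0 <ᵇ P j) ≡ true → ∃ λ j → 0 < P j
  witness {P} any≡true
    with anyFin (dim A) (λ j → 0 <ᵇ P j) | anyFin-reflects (λ j → <ᵇ-reflects-< 0 (P j))
  witness any≡true | true | ofʸ w = w

Binary : Mat → Set
Binary A = ∀ i j → ent A i j ≤ 1

_≼_ : Mat → Mat → Set
A ≼ B = ∀ r c → ent A r c ≤ 1 ⊎ ∃₂ λ r′ c′ → ent A r c ≤ ent B r′ c′

≼-binary : ∀ {A B} → A ≼ B → Binary B → Binary A
≼-binary A≼B binB r c with A≼B r c
... | inj₁ ≤1                = ≤1
... | inj₂ (r′ , c′ , ≤B)  = ≤-trans ≤B (binB r′ c′)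

Int-1⇒Binary : ∀ {A} → Int 1 A → Binary A
Int-1⇒Binary {mat d M} q r c = subst (M r c ≤_) (entrySum≡ q) (entry≤entrySum M r c)

LastPos : ∀ k → Square (suc k) → Fin (suc k) → Set
LastPos k M r = 0 < M r (fromℕ k)

index-witness : ∀ k M → FirstWitness (LastPos k M) (index k M)
index-witness k M = findFirst-witness (λ r → <ᵇ-reflects-< 0 (M r (fromℕ k)))

index-1-least : ∀ {k M i} → Least (LastPos k M) i → index-1 (mat (suc k) M) ≡ toℕ i
index-1-least {k} {M} l with index k M | index-witness k M
... | just _  | just l′     = cong toℕ (Least-unique l′ l)
... | nothing | nothing none = contradiction (Least.holds l) (none _)

index-1≤ : ∀ {k M r} → LastPos k M r → index-1 (mat (suc k) M) ≤ toℕ r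
index-1≤ {k} {M} {r} pos with index k M | index-witness k M
... | just i  | just l       = ≮⇒≥ (λ r<i → Least.below l r r<i pos)
... | nothing | nothing none = contradiction pos (none r)

index-1≢ : ∀ {k M r i} → LastPos k M r → ¬ LastPos k M i → index-1 (mat (suc k) M) ≢ toℕ i
index-1≢ {k} {M} {r} pos ¬pos with index k M | index-witness k M
... | just i′ | just l       =
  λ i′≡i → ¬pos (subst (LastPos k M) (Finₚ.toℕ-injective i′≡i) (Least.holds l))
... | nothing | nothing none = contradiction pos (none r)

index-1<dim : ∀ {n d M} → Int (suc n) (mat d M) → index-1 (mat d M) < d
index-1<dim {d = zero}  q = contradiction (entrySum≡ q) 0≢1+n
index-1<dim {d = suc k} {M} q with index k M
... | just i  = Finₚ.toℕ<n i
... | nothing = z<s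

positive⇒≤ : ∀ {n A} → Int n A → ∀ {r c} → 0 < ent A r c → r Fin.≤ c
positive⇒≤ q pos = ≮⇒≥ (λ c<r → n>0⇒n≢0 pos (upper q _ _ c<r))

last-diagonal-pos : ∀ {n k M} → Int n (mat (suc k) M) → LastPos k M (fromℕ k)
last-diagonal-pos {k = k} {M} q with rowPos q (fromℕ k)
... | c , pos with Finₚ.≤-antisym (Finₚ.≤fromℕ c) (positive⇒≤ q pos)
...   | refl = pos

index-1-Int1 : ∀ {A} → Int 1 A → index-1 A ≡ 0
index-1-Int1 {mat zero    M} q = refl
index-1-Int1 {mat (suc k) M} q with index k M | index-witness k M
... | nothing           | _      = refl
... | just Fin.zero     | _      = refl
... | just (Fin.suc i)  | just l =
  contradiction (subst (2 ≤_) (entrySum≡ q) two≤entrySum) λ { (s≤s ()) }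
  where
  two≤entrySum : 2 ≤ entrySum M
  two≤entrySum with rowPos q Fin.zero
  ... | c , pos = +-mono-≤ (≤-trans pos (≤-sumFin (suc k) (M Fin.zero) c))
                    (≤-trans (Least.holds l)
                      (≤-trans (≤-sumFin (suc k) (M (Fin.suc i)) (fromℕ k))
                               (≤-sumFin k (rowSum M ∘ Fin.suc) i)))

decrement : ∀ k → Square (suc k) → Fin (suc k) → Square (suc k)
decrement k M i r c = if (r ==F i) ∧ (c ==F fromℕ k) then M r c ∸ 1 else M r c

dropLast : ∀ {k} → Square (suc k) → Square k
dropLast M r c = M (inject₁ r) (inject₁ c)

moveToLast : ∀ k → Square (suc k) → Fin (suc k) → Square (suc k)
moveToLast k M i r c = if (c ==F fromℕ k) ∧ (toℕ r <ᵇ toℕ i) then M r i else M r c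

collapse : ∀ k → Square (suc k) → Fin (suc k) → Square k
collapse k M i r c = moveToLast k M i (punchIn i r) (punchIn i c)

data RemovalView (k : ℕ) (M : Square (suc k)) : Mat → Set where
  rem1-large : ∀ {i} → Least (LastPos k M) i → 1 < M i (fromℕ k) →
               RemovalView k M (mat (suc k) (decrement k M i))
  rem1-row   : ∀ {i j} → Least (LastPos k M) i → M i (fromℕ k) ≡ 1 → i ≢ fromℕ k →
               j ≢ fromℕ k → 0 < M i j → RemovalView k M (mat (suc k) (decrement k M i))
  rem2       : Least (LastPos k M) (fromℕ k) → M (fromℕ k) (fromℕ k) ≡ 1 →
               RemovalView k M (mat k (dropLast M))
  rem3       : ∀ {i} → Least (LastPos k M) i → M i (fromℕ k) ≡ 1 → i ≢ fromℕ k →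
               (∀ j → j ≢ fromℕ k → M i j ≡ 0) → RemovalView k M (mat k (collapse k M i))

removal-view : ∀ {k M r} → LastPos k M r → RemovalView k M (removal (mat (suc k) M))
removal-view {k} {M} {r} pos with index k M | index-witness k M
... | nothing | nothing none = contradiction pos (none r)
... | just i  | just l with 1 <ᵇ M i (fromℕ k) | <ᵇ-reflects-< 1 (M i (fromℕ k))
...   | true  | ofʸ large  = rem1-large l large
...   | false | ofⁿ ¬large with i ==F fromℕ k | ==F-reflects i (fromℕ k)
...     | true  | ofʸ refl = rem2 l (1≮n∧0<n⇒n≡1 ¬large (Least.holds l))
...     | false | ofⁿ i≢L
        with anyFin (suc k) (λ j → not (j ==F fromℕ k) ∧ (0 <ᵇ M i j))
           | anyFin-reflects (λ j → ¬-reflects (==F-reflects j (fromℕ k)) ×-reflects <ᵇ-reflects-< 0 (M i j))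
...       | true  | ofʸ (j , j≢L , 0<Mij) =
  rem1-row l (1≮n∧0<n⇒n≡1 ¬large (Least.holds l)) i≢L j≢L 0<Mij
...       | false | ofⁿ none =
  rem3 l (1≮n∧0<n⇒n≡1 ¬large (Least.holds l)) i≢L
       (λ j j≢L → n≤0⇒n≡0 (≮⇒≥ (λ 0<Mij → none (j , j≢L , 0<Mij))))

data Step (A B : Mat) : Set where
  repeated : ¬ Binary A → index-1 B ≡ index-1 A → Step A B
  fresh    : A ≼ B → B ≼ A → index-1 B ≢ index-1 A → Step A B

module Decrement {m k} {M : Square (suc k)} {i} (q : Int (suc (suc m)) (mat (suc k) M))
                 (least : Least (LastPos k M) i) where

  private
    L = fromℕ k
    D = decrement k M i

  off-row : ∀ {r} c → r ≢ i → D r c ≡ M r c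
  off-row c r≢i rewrite ==F-≢ r≢i = refl

  off-col : ∀ r {c} → c ≢ L → D r c ≡ M r c
  off-col r c≢L with r ==F i
  ... | false = refl
  ... | true rewrite ==F-≢ c≢L = refl

  at-index : D i L ≡ M i L ∸ 1
  at-index rewrite ==F-refl i | ==F-refl L = refl

  D≤M : ∀ r c → D r c ≤ M r c
  D≤M r c with (r ==F i) ∧ (c ==F L)
  ... | true  = m∸n≤m (M r c) 1
  ... | false = ≤-refl

  entrySum-D : entrySum D + 1 ≡ entrySum M
  entrySum-D = sumFin-update k i
    (λ r r≢i → sumFin-cong (suc k) (λ c → off-row c r≢i))
    (sumFin-update k L (λ c c≢L → off-col i c≢L)
      (trans (cong (_+ 1) at-index) (m∸n+n≡m (Least.holds least))))

  Int-D : (∃ λ j → 0 < D i j) → (∃ λ r → 0 < D r L) → Int (suc m) (mat (suc k) D)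
  Int-D row-i col-L = record
    { upper     = λ r c c<r → n≤0⇒n≡0 (subst (D r c ≤_) (upper q r c c<r) (D≤M r c))
    ; entrySum≡ = +-cancelʳ-≡ 1 _ _ (trans entrySum-D (trans (entrySum≡ q) (+-comm 1 (suc m))))
    ; rowPos    = rowPos-D
    ; colPos    = colPos-D
    }
    where
    rowPos-D : ∀ r → ∃ λ c → 0 < D r c
    rowPos-D r with r Finₚ.≟ i
    ... | yes refl = row-i
    ... | no r≢i   = let c , pos = rowPos q r in c , subst (0 <_) (sym (off-row c r≢i)) pos
    colPos-D : ∀ c → ∃ λ r → 0 < D r c
    colPos-D c with c Finₚ.≟ L
    ... | yes refl = col-L
    ... | no c≢L   = let r , pos = colPos q c in r , subst (0 <_) (sym (off-col r c≢L)) pos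

  large-step : 1 < M i L → Int (suc m) (mat (suc k) D) × Step (mat (suc k) M) (mat (suc k) D)
  large-step large = Int-D (L , pos) (i , pos) , repeated (λ bin → <⇒≱ large (bin i L)) same-index
    where
    pos : 0 < D i L
    pos = subst (0 <_) (sym at-index) (m<n⇒0<n∸m large)
    least-D : Least (LastPos k D) i
    least-D = record
      { holds = pos
      ; below = λ r r<i → Least.below least r r<i ∘ subst (0 <_) (off-row L (Finₚ.<⇒≢ r<i))
      }
    same-index : index-1 (mat (suc k) D) ≡ index-1 (mat (suc k) M)
    same-index = trans (index-1-least {M = D} least-D) (sym (index-1-least {M = M} least))

  row-step : M i L ≡ 1 → i ≢ L → ∀ {j} → j ≢ L → 0 < M i j →
             Int (suc m) (mat (suc k) D) × Step (mat (suc k) M) (mat (suc k) D)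
  row-step val≡1 i≢L {j} j≢L pos =
    Int-D (j , subst (0 <_) (sym (off-col i j≢L)) pos) (L , last-pos) , fresh M≼D D≼M new-index
    where
    last-pos : 0 < D L L
    last-pos = subst (0 <_) (sym (off-row L (i≢L ∘ sym))) (last-diagonal-pos q)
    M≼D : mat (suc k) M ≼ mat (suc k) D
    M≼D r c with r Finₚ.≟ i | c Finₚ.≟ L
    ... | yes refl | yes refl = inj₁ (≤-reflexive val≡1)
    ... | yes refl | no c≢L   = inj₂ (r , c , ≤-reflexive (sym (off-col r c≢L)))
    ... | no r≢i   | _        = inj₂ (r , c , ≤-reflexive (sym (off-row c r≢i)))
    D≼M : mat (suc k) D ≼ mat (suc k) M
    D≼M r c = inj₂ (r , c , D≤M r c)
    D-at-index≡0 : D i L ≡ 0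
    D-at-index≡0 = trans at-index (cong (_∸ 1) val≡1)
    new-index : index-1 (mat (suc k) D) ≢ index-1 (mat (suc k) M)
    new-index same = index-1≢ {M = D} last-pos (λ pos → n>0⇒n≢0 pos D-at-index≡0)
                               (trans same (index-1-least {M = M} least))

module DropLast {m k} {M : Square (suc k)} (q : Int (suc (suc m)) (mat (suc k) M))
                (least : Least (LastPos k M) (fromℕ k)) (val≡1 : M (fromℕ k) (fromℕ k) ≡ 1) where

  private
    L = fromℕ k
    B = dropLast M

  last-column≡0 : ∀ r → M (inject₁ r) L ≡ 0
  last-column≡0 r = n≤0⇒n≡0 (≮⇒≥ (Least.below least (inject₁ r) (inject₁<fromℕ r)))

  last-row≡0 : ∀ c → M L (inject₁ c) ≡ 0
  last-row≡0 c = upper q L (inject₁ c) (inject₁<fromℕ c)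

  entrySum-M : entrySum M ≡ 1 + entrySum B
  entrySum-M = begin
    entrySum M                                     ≡⟨ sumFin-fromℕ k (rowSum M) ⟩
    rowSum M L + sumFin k (rowSum M ∘ inject₁)     ≡⟨ cong₂ _+_ last-row (sumFin-cong k upper-row) ⟩
    1 + entrySum B                                 ∎
    where
    open ≡-Reasoning
    last-row : rowSum M L ≡ 1
    last-row = trans (sumFin-fromℕ k (M L)) (cong₂ _+_ val≡1 (sumFin-zero k last-row≡0))
    upper-row : ∀ r → rowSum M (inject₁ r) ≡ rowSum B r
    upper-row r = trans (sumFin-fromℕ k (M (inject₁ r))) (cong (_+ rowSum B r) (last-column≡0 r))

  Int-B : Int (suc m) (mat k B)
  Int-B = record
    { upper     = λ r c c<r → upper q (inject₁ r) (inject₁ c)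
                    (subst₂ ℕ._<_ (sym (Finₚ.toℕ-inject₁ c)) (sym (Finₚ.toℕ-inject₁ r)) c<r)
    ; entrySum≡ = suc-injective (trans (sym entrySum-M) (entrySum≡ q))
    ; rowPos    = rowPos-B
    ; colPos    = colPos-B
    }
    where
    rowPos-B : ∀ r → ∃ λ c → 0 < B r c
    rowPos-B r with rowPos q (inject₁ r)
    ... | c , pos with inject₁-surjective c (λ { refl → n>0⇒n≢0 pos (last-column≡0 r) })
    ...   | c′ , refl = c′ , pos
    colPos-B : ∀ c → ∃ λ r → 0 < B r c
    colPos-B c with colPos q (inject₁ c)
    ... | r , pos with inject₁-surjective r (λ { refl → n>0⇒n≢0 pos (last-row≡0 c) })
    ...   | r′ , refl = r′ , pos

  step : Step (mat (suc k) M) (mat k B)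
  step = fresh M≼B B≼M new-index
    where
    M≼B : mat (suc k) M ≼ mat k B
    M≼B r c with r Finₚ.≟ L | c Finₚ.≟ L
    ... | yes refl | yes refl = inj₁ (≤-reflexive val≡1)
    ... | yes refl | no c≢L with inject₁-surjective c c≢L
    ...   | c′ , refl = inj₁ (≡0⇒≤ (last-row≡0 c′))
    M≼B r c | no r≢L | yes refl with inject₁-surjective r r≢L
    ...   | r′ , refl = inj₁ (≡0⇒≤ (last-column≡0 r′))
    M≼B r c | no r≢L | no c≢L with inject₁-surjective r r≢L | inject₁-surjective c c≢L
    ...   | r′ , refl | c′ , refl = inj₂ (r′ , c′ , ≤-refl)
    B≼M : mat k B ≼ mat (suc k) M
    B≼M r c = inj₂ (inject₁ r , inject₁ c , ≤-refl)
    new-index : index-1 (mat k B) ≢ index-1 (mat (suc k) M)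
    new-index same = <-irrefl (trans same (trans (index-1-least {M = M} least) (Finₚ.toℕ-fromℕ k)))
                              (index-1<dim Int-B)

module Collapse {m k} {M : Square (suc (suc k))} {i} (q : Int (suc (suc m)) (mat (suc (suc k)) M))
                (least : Least (LastPos (suc k) M) i) (val≡1 : M i (fromℕ (suc k)) ≡ 1)
                (i≢L : i ≢ fromℕ (suc k)) (row-i≡0 : ∀ j → j ≢ fromℕ (suc k) → M i j ≡ 0) where

  private
    L  = fromℕ (suc k)
    L′ = fromℕ k
    N  = moveToLast (suc k) M i
    C  = collapse (suc k) M i

  punchIn-L′ : punchIn i L′ ≡ L
  punchIn-L′ = punchIn-fromℕ-fromℕ k i i≢L

  N-off-last : ∀ r {c} → c ≢ L → N r c ≡ M r c
  N-off-last r c≢L rewrite ==F-≢ c≢L = refl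

  N-not-above : ∀ {r} c → ¬ r Fin.< i → N r c ≡ M r c
  N-not-above {r} c r≮i rewrite det (<ᵇ-reflects-< (toℕ r) (toℕ i)) (ofⁿ r≮i) with c ==F L
  ... | true  = refl
  ... | false = refl

  N-moved : ∀ {r} → r Fin.< i → N r L ≡ M r i
  N-moved {r} r<i rewrite ==F-refl L | det (<ᵇ-reflects-< (toℕ r) (toℕ i)) (ofʸ r<i) = refl

  N-entry : ∀ r c → N r c ≡ M r i ⊎ N r c ≡ M r c
  N-entry r c with (c ==F L) ∧ (toℕ r <ᵇ toℕ i)
  ... | true  = inj₁ refl
  ... | false = inj₂ refl

  last-above-i≡0 : ∀ {r} → r Fin.< i → M r L ≡ 0
  last-above-i≡0 r<i = n≤0⇒n≡0 (≮⇒≥ (Least.below least _ r<i))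

  column-i-below≡0 : ∀ {r} → r ≢ i → ¬ r Fin.< i → M r i ≡ 0
  column-i-below≡0 r≢i r≮i = upper q _ i (Finₚ.≤∧≢⇒< (≮⇒≥ r≮i) (r≢i ∘ sym))

  column-i-above : ∀ {r} → r ≢ i → 0 < M r i → r Fin.< i
  column-i-above r≢i pos = Finₚ.≤∧≢⇒< (positive⇒≤ q pos) r≢i

  C-moved : ∀ {r′} → punchIn i r′ Fin.< i → C r′ L′ ≡ M (punchIn i r′) i
  C-moved r<i = trans (cong (N _) punchIn-L′) (N-moved r<i)

  M≤N : ∀ r c → M r c ≤ N r c
  M≤N r c with c Finₚ.≟ L | r Finₚ.<? i
  ... | yes refl | yes r<i = ≡0⇒≤ (last-above-i≡0 r<i)
  ... | yes refl | no r≮i  = ≤-reflexive (sym (N-not-above c r≮i))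
  ... | no c≢L   | _       = ≤-reflexive (sym (N-off-last r c≢L))

  rowSum-N : ∀ {r} → r ≢ i → rowSum N r ≡ rowSum M r + M r i
  rowSum-N {r} r≢i with r Finₚ.<? i
  ... | yes r<i = sym (sumFin-update (suc k) L (λ c c≢L → sym (N-off-last r c≢L))
                        (trans (cong (_+ M r i) (last-above-i≡0 r<i)) (sym (N-moved r<i))))
  ... | no r≮i  = begin
    rowSum N r          ≡⟨ sumFin-cong (suc (suc k)) (λ c → N-not-above c r≮i) ⟩
    rowSum M r          ≡⟨ +-identityʳ _ ⟨
    rowSum M r + 0      ≡⟨ cong (rowSum M r +_) (column-i-below≡0 r≢i r≮i) ⟨
    rowSum M r + M r i  ∎
    where open ≡-Reasoning

  rowSum-C : ∀ r′ → rowSum C r′ ≡ rowSum M (punchIn i r′)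
  rowSum-C r′ = +-cancelˡ-≡ (M r i) _ _ (begin
    M r i + rowSum C r′  ≡⟨ cong (_+ rowSum C r′) (N-off-last r i≢L) ⟨
    N r i + rowSum C r′  ≡⟨ sumFin-punchIn (suc k) i (N r) ⟨
    rowSum N r           ≡⟨ rowSum-N (Finₚ.punchInᵢ≢i i r′) ⟩
    rowSum M r + M r i   ≡⟨ +-comm _ (M r i) ⟩
    M r i + rowSum M r   ∎)
    where
    open ≡-Reasoning
    r = punchIn i r′

  entrySum-M : entrySum M ≡ 1 + entrySum C
  entrySum-M = begin
    entrySum M                                          ≡⟨ sumFin-punchIn (suc k) i (rowSum M) ⟩
    rowSum M i + sumFin (suc k) (rowSum M ∘ punchIn i)
      ≡⟨ cong₂ _+_ row-i (sym (sumFin-cong (suc k) rowSum-C)) ⟩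
    1 + entrySum C                                      ∎
    where
    open ≡-Reasoning
    row-i : rowSum M i ≡ 1
    row-i = trans (sumFin-fromℕ (suc k) (M i))
              (cong₂ _+_ val≡1 (sumFin-zero (suc k) (λ x → row-i≡0 (inject₁ x) (Finₚ.fromℕ≢inject₁ ∘ sym))))

  Int-C : Int (suc m) (mat (suc k) C)
  Int-C = record
    { upper     = upper-C
    ; entrySum≡ = suc-injective (trans (sym entrySum-M) (entrySum≡ q))
    ; rowPos    = rowPos-C
    ; colPos    = colPos-C
    }
    where
    upper-C : ∀ r′ c′ → c′ Fin.< r′ → C r′ c′ ≡ 0
    upper-C r′ c′ c′<r′ = trans (N-off-last r c≢L) (upper q r c c<r)
      where
      r = punchIn i r′
      c = punchIn i c′
      c<r : c Fin.< r
      c<r = punchIn-mono-< i c′ r′ c′<r′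
      c≢L : c ≢ L
      c≢L c≡L = <⇒≱ (subst (Fin._< r) c≡L c<r) (Finₚ.≤fromℕ r)
    rowPos-C : ∀ r′ → ∃ λ c′ → 0 < C r′ c′
    rowPos-C r′ with rowPos q (punchIn i r′)
    ... | c , pos with c Finₚ.≟ i
    ...   | yes refl = L′ , subst (0 <_) (sym (C-moved (column-i-above (Finₚ.punchInᵢ≢i i r′) pos))) pos
    ...   | no c≢i with punchIn-surjective i c c≢i
    ...     | c′ , refl = c′ , ≤-trans pos (M≤N (punchIn i r′) c)
    colPos-C : ∀ c′ → ∃ λ r′ → 0 < C r′ c′
    colPos-C c′ with punchIn i c′ Finₚ.≟ L
    ... | yes c≡L = L′ , subst₂ (λ r c → 0 < N r c) (sym punchIn-L′) (sym c≡L)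
                           (≤-trans (last-diagonal-pos q) (M≤N L L))
    ... | no c≢L with colPos q (punchIn i c′)
    ...   | r , pos with punchIn-surjective i r (λ { refl → n>0⇒n≢0 pos (row-i≡0 _ c≢L) })
    ...     | r′ , refl = r′ , ≤-trans pos (M≤N r (punchIn i c′))

  step : Step (mat (suc (suc k)) M) (mat (suc k) C)
  step = fresh M≼C C≼M new-index
    where
    C≼M : mat (suc k) C ≼ mat (suc (suc k)) M
    C≼M r′ c′ with N-entry (punchIn i r′) (punchIn i c′)
    ... | inj₁ moved = inj₂ (punchIn i r′ , i , ≤-reflexive moved)
    ... | inj₂ kept  = inj₂ (punchIn i r′ , punchIn i c′ , ≤-reflexive kept)
    M≼C : mat (suc (suc k)) M ≼ mat (suc k) C
    M≼C r c with r Finₚ.≟ i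
    M≼C r c | yes refl with c Finₚ.≟ L
    ... | yes refl = inj₁ (≤-reflexive val≡1)
    ... | no c≢L   = inj₁ (≡0⇒≤ (row-i≡0 c c≢L))
    M≼C r c | no r≢i with punchIn-surjective i r r≢i
    ... | r′ , refl with c Finₚ.≟ i
    ...   | no c≢i with punchIn-surjective i c c≢i
    ...     | c′ , refl = inj₂ (r′ , c′ , M≤N r c)
    M≼C r c | no r≢i | r′ , refl | yes refl with r Finₚ.<? i
    ...     | yes r<i = inj₂ (r′ , L′ , ≤-reflexive (sym (C-moved r<i)))
    ...     | no r≮i  = inj₁ (≡0⇒≤ (column-i-below≡0 r≢i r≮i))
    new-index : index-1 (mat (suc k) C) ≢ index-1 (mat (suc (suc k)) M)
    new-index with colPos q i
    ... | r , pos with punchIn-surjective i r (λ { refl → n>0⇒n≢0 pos (row-i≡0 i i≢L) })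
    ...   | r′ , refl = <⇒≢ (begin-strict
      index-1 (mat (suc k) C)  ≤⟨ index-1≤ {M = C} (subst (0 <_) (sym (C-moved r<i)) pos) ⟩
      toℕ r′                   ≤⟨ toℕ≤toℕ-punchIn i r′ ⟩
      toℕ r                    <⟨ r<i ⟩
      toℕ i                    ≡⟨ index-1-least {M = M} least ⟨
      index-1 (mat (suc (suc k)) M) ∎)
      where
      open ≤-Reasoning
      r<i : r Fin.< i
      r<i = column-i-above (Finₚ.punchInᵢ≢i i r′) pos

collapse-step : ∀ {m k M i} → Int (suc (suc m)) (mat (suc k) M) → Least (LastPos k M) i →
                M i (fromℕ k) ≡ 1 → i ≢ fromℕ k → (∀ j → j ≢ fromℕ k → M i j ≡ 0) →
                Int (suc m) (mat k (collapse k M i)) × Step (mat (suc k) M) (mat k (collapse k M i))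
collapse-step {k = zero}  {i = Fin.zero} _ _ _ i≢L _ = contradiction refl i≢L
collapse-step {k = suc k} q least val≡1 i≢L row-i≡0 =
  Collapse.Int-C q least val≡1 i≢L row-i≡0 , Collapse.step q least val≡1 i≢L row-i≡0

removal-step : ∀ {m} A → Int (suc (suc m)) A → Int (suc m) (removal A) × Step A (removal A)
removal-step (mat zero M) q = contradiction (entrySum≡ q) 0≢1+n
removal-step (mat (suc k) M) q
  with removal (mat (suc k) M) | removal-view {k} {M} (proj₂ (colPos q (fromℕ k)))
... | _ | rem1-large least large             = Decrement.large-step q least large
... | _ | rem1-row least val≡1 i≢L j≢L pos  = Decrement.row-step q least val≡1 i≢L j≢L pos
... | _ | rem2 least val≡1                   = DropLast.Int-B q least val≡1 , DropLast.step q least val≡1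
... | _ | rem3 least val≡1 i≢L row-i≡0       = collapse-step q least val≡1 i≢L row-i≡0

Γ-last : ∀ m {A} → Int (suc m) A → ∃ λ xs → Γ (suc m) A ≡ xs ++ [ index-1 A ]
Γ-last zero    q = [] , cong [_] (sym (index-1-Int1 q))
Γ-last (suc m) {A} q = Γ (suc m) (removal A) , refl

Step-binary⇔ : ∀ {A B} {P Q : Set} → Step A B → Binary B ⇔ P →
               Q ⇔ (P × index-1 B ≢ index-1 A) → Binary A ⇔ Q
Step-binary⇔ (repeated ¬binA same) _ Q⇔ =
  mk⇔ (⊥-elim ∘ ¬binA) (λ q → contradiction same (proj₂ (Equivalence.to Q⇔ q)))
Step-binary⇔ (fresh A≼B B≼A new) B⇔P Q⇔ =
  mk⇔ (λ binA → Equivalence.from Q⇔ (Equivalence.to B⇔P (≼-binary B≼A binA) , new))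
      (λ q → ≼-binary A≼B (Equivalence.from B⇔P (proj₁ (Equivalence.to Q⇔ q))))

Binary⇔Linked : ∀ m A → Int (suc m) A → Binary A ⇔ Linked _≢_ (Γ (suc m) A)
Binary⇔Linked zero    A q = mk⇔ (λ _ → [-]) (λ _ → Int-1⇒Binary q)
Binary⇔Linked (suc m) A q with removal-step A q
... | q′ , step with Γ-last m q′
... | xs , Γ≡ = Step-binary⇔ step (Binary⇔Linked m (removal A) q′) (subst snoc⇔ (sym Γ≡) (Linked-snoc⇔ xs))
  where
  snoc⇔ : List ℕ → Set
  snoc⇔ ys = Linked _≢_ (ys ++ [ index-1 A ]) ⇔ (Linked _≢_ ys × index-1 (removal A) ≢ index-1 A)

mainTheorem10 : (n : ℕ) → 1 ≤ n → (A : Mat) → IsInt n A →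
                ((∀ (i j : Fin (dim A)) → ent A i j ≡ 0 ⊎ ent A i j ≡ 1)
                 ⇔ Linked _≢_ (Γ n A))
mainTheorem10 (suc m) _ A h = mk⇔
  (λ zero-or-one → to (λ i j → [ ≡0⇒≤ , ≤-reflexive ]′ (zero-or-one i j)))
  (λ linked i j → n≤1⇒n≡0∨n≡1 (from linked i j))
  where open Equivalence (Binary⇔Linked m A (IsInt⇒Int h))
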